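{- For every positive integer $n$, the number of gap-free partitions of $n$ with at least two distinct part values equals the sum of the smallest parts of the partitions of $n$ into distinct parts with an even number of parts: \[ \left|\mathcal{G}(n)\setminus\mathcal{G}^0(n)\right|=\sum_{\lambda\in\mathcal{D_E}(n)}s(\lambda). \]
   Context: A partition is gap-free if its distinct part values are consecutive integers. $\mathcal{G}(n)$ is the set of gap-free partitions of $n$; $\mathcal{G}^0(n)$ is the set of partitions of $n$ having exactly one distinct part value. $\mathcal{D_E}(n)$ is the set of partitions of $n$ into distinct parts with an even number of parts, and $s(\lambda)$ denotes the smallest part of $\lambda$. -}

module Defs where

open import Data.Nat using (ℕ; zero; suc; _≤_; _<_; _⊓_)
open import Data.Nat.Divisibility using (_∣_)
open import Data.List using (List; []; _∷_; length)
open import Data.Nat.ListAction using (sum)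
open import Data.List.Relation.Unary.All using (All)
open import Data.List.Relation.Unary.Linked using (Linked)
open import Data.List.Relation.Unary.Unique.Propositional using (Unique)
open import Data.List.Membership.Propositional using (_∈_)
open import Data.Product using (_×_; ∃-syntax)
open import Function.Bundles using (_⇔_)
open import Relation.Binary.PropositionalEquality using (_≡_)
open import Relation.Nullary using (¬_)

IsPartition : ℕ → List ℕ → Set
IsPartition n λ' = All (0 <_) λ' × Linked (λ x y → y ≤ x) λ' × sum λ' ≡ n

GapFree : List ℕ → Set
GapFree λ' = ∀ a b c → a ∈ λ' → b ∈ λ' → a ≤ c → c ≤ b → c ∈ λ'

TwoDistinctValues : List ℕ → Set
TwoDistinctValues λ' = ∃[ a ] ∃[ b ] (a ∈ λ' × b ∈ λ' × ¬ (a ≡ b))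

InGminusG0 : ℕ → List ℕ → Set
InGminusG0 n λ' = IsPartition n λ' × GapFree λ' × TwoDistinctValues λ'

InDE : ℕ → List ℕ → Set
InDE n λ' = IsPartition n λ' × Unique λ' × 2 ∣ length λ'

-- smallest part s(λ) (convention: 0 for the empty partition)
smallest : List ℕ → ℕ
smallest [] = 0
smallest (x ∷ []) = x
smallest (x ∷ y ∷ ys) = x ⊓ smallest (y ∷ ys)

Enumerates : (List ℕ → Set) → List (List ℕ) → Set
Enumerates P L = Unique L × (∀ x → (x ∈ L) ⇔ P x)

-- Write a gap-free partition π with at least two part values and smallest part e + 1 as
-- e + ρ. Then the part values of ρ are 1, 2, …, r with r ≥ 2, so the conjugate σ of ρ is a
-- partition into at least two distinct parts, and |π| = |σ| + e·σ₁. On the other side, a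
-- partition l ∈ D_E(n) together with 0 ≤ i < s(l) amounts to a partition ν = l − i into an
-- even number L of distinct parts, with n = |ν| + i·L. For fixed L, the map `step` on pairs
-- (σ, e) with σ a partition into L or L + 1 distinct parts raises |σ| + e·σ₁ by exactly L,
-- is injective, and misses exactly the pairs (ν, 0) with ν of length L. Hence each (σ, e) is
-- reached from exactly one (ν, 0) in exactly one number i of steps, and |σ| + e·σ₁ = |ν| + i·L.
-- As every length ≥ 2 is L or L + 1 for exactly one even L, this gives a bijection between the
-- pairs (l, i) and G(n) ∖ G⁰(n); there are Σ_{λ ∈ D_E(n)} s(λ) such pairs.

module Submission where

open import Defs
open import Data.Empty using (⊥-elim)
open import Data.List using (List; []; _∷_; _∷ʳ_; _++_; length; map; replicate; upTo)
open import Data.List.Membership.Propositional using (_∈_; _∉_)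
open import Data.List.Membership.Propositional.Properties
  using (∈-++⁻; ∈-++⁺ˡ; ∈-++⁺ʳ; ∈-map⁻; ∈-map⁺; ∈-upTo⁺; ∈-upTo⁻)
open import Data.List.Membership.Propositional.Properties.WithK using (unique∧set⇒bag)
open import Data.List.Properties
  using ( length-++; length-map; length-replicate; length-upTo
        ; ++-identityʳ; map-injective; ∷-injective; ∷ʳ-injectiveˡ)
open import Data.List.Relation.Binary.BagAndSetEquality using (∼bag⇒↭)
open import Data.List.Relation.Binary.Permutation.Propositional.Properties using (↭-length)
open import Data.List.Relation.Unary.All as All using (All; []; _∷_)
open import Data.List.Relation.Unary.All.Properties using (++⁺; map⁺; map⁻; replicate⁺)
open import Data.List.Relation.Unary.AllPairs as AllPairs using ([]; _∷_)
open import Data.List.Relation.Unary.Any using (here; there)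
open import Data.List.Relation.Unary.Linked as Linked using (Linked; []; [-]; _∷_)
import Data.List.Relation.Unary.Linked.Properties as Linkedₚ
open import Data.List.Relation.Unary.Unique.Propositional using (Unique)
import Data.List.Relation.Unary.Unique.Propositional.Properties as Uniqueₚ
open import Data.Nat using (ℕ; zero; suc; _+_; _*_; _∸_; _≤_; _<_; _⊓_; z≤n; s≤s; z<s; _≟_)
open import Data.Nat.Divisibility using (_∣_; divides; ∣-refl; ∣m∣n⇒∣m+n; ∣m+n∣m⇒∣n; ∣1⇒≡1; ∣⇒≤)
open import Data.Nat.GeneralisedArithmetic using (fold)
open import Data.Nat.Induction using (<-wellFounded)
open import Data.Nat.ListAction using (sum)
open import Data.Nat.ListAction.Properties using (sum-++)
open import Data.Nat.Properties
open import Data.Nat.Tactic.RingSolver using (solve-∀)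
open import Data.Product using (_×_; _,_; proj₁; proj₂; ∃-syntax)
open import Data.Sum using (_⊎_; inj₁; inj₂; [_,_]′)
open import Function.Bundles using (_⇔_; mk⇔; Equivalence)
open import Induction.WellFounded using (Acc; acc)
open import Relation.Binary.PropositionalEquality
open import Relation.Nullary using (¬_; yes; no)

-- Orbits

module Orbits {X : Set} (State Base : X → Set) (next : X → X) (weight : X → ℕ) {k : ℕ} (0<k : 0 < k)
  (next-state     : ∀ {x} → State x → State (next x))
  (weight-next    : ∀ {x} → State x → weight (next x) ≡ weight x + k)
  (next-injective : ∀ {x y} → State x → State y → next x ≡ next y → x ≡ y)
  (next-nonBase   : ∀ {x} → State x → ¬ Base (next x))
  (base⊎next      : ∀ {y} → State y → Base y ⊎ ∃[ x ] (State x × next x ≡ y))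
  where

  orbit : X → ℕ → X
  orbit x u = fold x next u

  orbit-state : ∀ {x} u → State x → State (orbit x u)
  orbit-state zero    s = s
  orbit-state (suc u) s = next-state (orbit-state u s)

  weight-orbit : ∀ {x} u → State x → weight (orbit x u) ≡ weight x + u * k
  weight-orbit     zero    s = sym (+-identityʳ _)
  weight-orbit {x} (suc u) s = begin
    weight (next (orbit x u))  ≡⟨ weight-next (orbit-state u s) ⟩
    weight (orbit x u) + k     ≡⟨ cong (_+ k) (weight-orbit u s) ⟩
    weight x + u * k + k       ≡⟨ +-assoc (weight x) (u * k) k ⟩
    weight x + (u * k + k)     ≡⟨ cong (weight x +_) (+-comm (u * k) k) ⟩
    weight x + suc u * k       ∎
    where open ≡-Reasoning

  orbit-injective : ∀ {b b′} u u′ → State b → State b′ → Base b → Base b′ →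
    orbit b u ≡ orbit b′ u′ → b ≡ b′ × u ≡ u′
  orbit-injective zero    zero     _ _  _  _   eq = eq , refl
  orbit-injective zero    (suc u′) _ s′ bb _   eq =
    ⊥-elim (next-nonBase (orbit-state u′ s′) (subst Base eq bb))
  orbit-injective (suc u) zero     s _  _  bb′ eq =
    ⊥-elim (next-nonBase (orbit-state u s) (subst Base (sym eq) bb′))
  orbit-injective (suc u) (suc u′) s s′ bb bb′ eq
    with orbit-injective u u′ s s′ bb bb′ (next-injective (orbit-state u s) (orbit-state u′ s′) eq)
  ... | refl , refl = refl , refl

  orbit-surjective : ∀ {y} → State y → ∃[ b ] ∃[ u ] (State b × Base b × orbit b u ≡ y)
  orbit-surjective s = go (<-wellFounded _) s
    where
    go : ∀ {y} → Acc _<_ (weight y) → State y → ∃[ b ] ∃[ u ] (State b × Base b × orbit b u ≡ y)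
    go (acc rec) s with base⊎next s
    ... | inj₁ bb = _ , 0 , s , bb , refl
    ... | inj₂ (x , sx , refl) with go (rec (subst (weight x <_) (sym (weight-next sx)) (m<m+n _ 0<k))) sx
    ...   | b , u , sb , bb , refl = b , suc u , sb , bb , refl

Nonincreasing : List ℕ → Set
Nonincreasing = Linked (λ a b → b ≤ a)

Decreasing : List ℕ → Set
Decreasing = Linked (λ a b → b < a)

Contiguous : List ℕ → Set
Contiguous = Linked (λ a b → a ≡ b ⊎ a ≡ suc b)

Positive : List ℕ → Set
Positive = All (0 <_)

firstPart : List ℕ → ℕ
firstPart []      = 0
firstPart (x ∷ _) = x

data EndsIn (v : ℕ) : List ℕ → Set where
  last : EndsIn v (v ∷ [])
  _∷_ : ∀ x {xs} → EndsIn v xs → EndsIn v (x ∷ xs)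

decreasing⇒nonincreasing : ∀ {xs} → Decreasing xs → Nonincreasing xs
decreasing⇒nonincreasing = Linked.map <⇒≤

contiguous⇒nonincreasing : ∀ {xs} → Contiguous xs → Nonincreasing xs
contiguous⇒nonincreasing = Linked.map λ { (inj₁ refl) → ≤-refl ; (inj₂ refl) → n≤1+n _ }

firstPart-≤ : ∀ {x xs} → Nonincreasing (x ∷ xs) → firstPart xs ≤ x
firstPart-≤ [-]       = z≤n
firstPart-≤ (x≥y ∷ _) = x≥y

∈⇒≤-firstPart : ∀ {x xs} → Nonincreasing xs → x ∈ xs → x ≤ firstPart xs
∈⇒≤-firstPart _         (here refl) = ≤-refl
∈⇒≤-firstPart (x≥y ∷ d) (there x∈)  = ≤-trans (∈⇒≤-firstPart d x∈) x≥y

EndsIn-∈ : ∀ {v xs} → EndsIn v xs → v ∈ xs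
EndsIn-∈ last   = here refl
EndsIn-∈ (_ ∷ e) = there (EndsIn-∈ e)

EndsIn-++⁺ʳ : ∀ {v} xs {ys} → EndsIn v ys → EndsIn v (xs ++ ys)
EndsIn-++⁺ʳ []       e = e
EndsIn-++⁺ʳ (x ∷ xs) e = x ∷ EndsIn-++⁺ʳ xs e

EndsIn-map⁺ : ∀ {v xs} (f : ℕ → ℕ) → EndsIn v xs → EndsIn (f v) (map f xs)
EndsIn-map⁺ f last   = last
EndsIn-map⁺ f (x ∷ e) = f x ∷ EndsIn-map⁺ f e

EndsIn-replicate : ∀ k v → EndsIn v (replicate (suc k) v)
EndsIn-replicate zero    v = last
EndsIn-replicate (suc k) v = v ∷ EndsIn-replicate k v

Linked-∷ʳ : ∀ {R : ℕ → ℕ → Set} {xs z} → Linked R xs → All (λ a → R a z) xs → Linked R (xs ∷ʳ z)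
Linked-∷ʳ []       []       = [-]
Linked-∷ʳ [-]      (r ∷ []) = r ∷ [-]
Linked-∷ʳ (r ∷ rs) (_ ∷ as) = r ∷ Linked-∷ʳ rs as

Linked-++ : ∀ {R : ℕ → ℕ → Set} {a b xs ys} →
  Linked R xs → EndsIn a xs → R a b → Linked R (b ∷ ys) → Linked R (xs ++ b ∷ ys)
Linked-++ _        last   r rs = r ∷ rs
Linked-++ (r ∷ rs) (_ ∷ e) r′ rs′ = r ∷ Linked-++ rs e r′ rs′

Linked-++⁻ˡ : ∀ {R : ℕ → ℕ → Set} xs {ys} → Linked R (xs ++ ys) → Linked R xs
Linked-++⁻ˡ []           _        = []
Linked-++⁻ˡ (x ∷ [])     _        = [-]
Linked-++⁻ˡ (x ∷ y ∷ xs) (r ∷ rs) = r ∷ Linked-++⁻ˡ (y ∷ xs) rs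

length-∷ʳ : ∀ (xs : List ℕ) z → length (xs ∷ʳ z) ≡ suc (length xs)
length-∷ʳ []       z = refl
length-∷ʳ (x ∷ xs) z = cong suc (length-∷ʳ xs z)

sum-∷ʳ-0 : ∀ xs → sum (xs ∷ʳ 0) ≡ sum xs
sum-∷ʳ-0 xs = trans (sum-++ xs (0 ∷ [])) (+-identityʳ (sum xs))

firstPart-∷ʳ-0 : ∀ xs → firstPart (xs ∷ʳ 0) ≡ firstPart xs
firstPart-∷ʳ-0 []      = refl
firstPart-∷ʳ-0 (_ ∷ _) = refl

smallest-≤ : ∀ {x xs} → x ∈ xs → smallest xs ≤ x
smallest-≤ {xs = y ∷ []}     (here refl) = ≤-refl
smallest-≤ {xs = y ∷ z ∷ zs} (here refl) = m⊓n≤m y (smallest (z ∷ zs))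
smallest-≤ {xs = y ∷ z ∷ zs} (there x∈)  = ≤-trans (m⊓n≤n y (smallest (z ∷ zs))) (smallest-≤ x∈)

smallest-∈ : ∀ {x xs} → x ∈ xs → smallest xs ∈ xs
smallest-∈ {xs = y ∷ []}     _ = here refl
smallest-∈ {xs = y ∷ z ∷ zs} _ =
  [ here , (λ eq → there (subst (_∈ z ∷ zs) (sym eq) (smallest-∈ {xs = z ∷ zs} (here refl)))) ]′
  (⊓-sel y (smallest (z ∷ zs)))

<smallest⇒All : ∀ {i xs} → i < smallest xs → All (i <_) xs
<smallest⇒All i< = All.tabulate λ x∈ → <-≤-trans i< (smallest-≤ x∈)

All⇒<smallest : ∀ {i xs} → All (i <_) xs → 0 < length xs → i < smallest xs
All⇒<smallest {xs = _ ∷ _} all _ = All.lookup all (smallest-∈ (here refl))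

smallest-EndsIn : ∀ {v xs} → Nonincreasing xs → EndsIn v xs → smallest xs ≡ v
smallest-EndsIn _         last    = refl
smallest-EndsIn (x≥y ∷ d) (x ∷ e) =
  trans (cong (x ⊓_) (smallest-EndsIn d e)) (m≥n⇒m⊓n≡n (≤-trans (∈⇒≤-firstPart d (EndsIn-∈ e)) x≥y))

EndsIn-smallest : ∀ {x xs} → Nonincreasing (x ∷ xs) → EndsIn (smallest (x ∷ xs)) (x ∷ xs)
EndsIn-smallest {x} {[]}     _         = last
EndsIn-smallest {x} {y ∷ ys} (x≥y ∷ d) =
  subst (λ v → EndsIn v (x ∷ y ∷ ys)) (sym (m≥n⇒m⊓n≡n (≤-trans (smallest-≤ {xs = y ∷ ys} (here refl)) x≥y)))
        (x ∷ EndsIn-smallest d)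

smallest-map-+ : ∀ i x xs → smallest (map (i +_) (x ∷ xs)) ≡ i + smallest (x ∷ xs)
smallest-map-+ i x []       = refl
smallest-map-+ i x (y ∷ ys) =
  trans (cong ((i + x) ⊓_) (smallest-map-+ i y ys)) (sym (+-distribˡ-⊓ i x (smallest (y ∷ ys))))

shift-view : ∀ {i xs} → All (i ≤_) xs → ∃[ ys ] xs ≡ map (i +_) ys
shift-view []                = [] , refl
shift-view {i} {x ∷ _} (i≤x ∷ i≤xs) with shift-view i≤xs
... | ys , refl = x ∸ i ∷ ys , cong (_∷ map (i +_) ys) (sym (m+[n∸m]≡n i≤x))

map-∸-+ : ∀ i ys → map (_∸ i) (map (i +_) ys) ≡ ys
map-∸-+ i []       = refl
map-∸-+ i (y ∷ ys) = cong₂ _∷_ (m+n∸m≡n i y) (map-∸-+ i ys)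

sum-map-+ : ∀ i xs → sum (map (i +_) xs) ≡ sum xs + i * length xs
sum-map-+ i []       = sym (*-zeroʳ i)
sum-map-+ i (x ∷ xs) = trans (cong (i + x +_) (sum-map-+ i xs)) (rearrange i x (sum xs) (length xs))
  where
  rearrange : ∀ i x s k → i + x + (s + i * k) ≡ x + s + i * suc k
  rearrange = solve-∀

sum-map-suc : ∀ xs → sum (map suc xs) ≡ sum xs + length xs
sum-map-suc xs = trans (sum-map-+ 1 xs) (cong (sum xs +_) (*-identityˡ (length xs)))

+-decreasing⁺ : ∀ i {ys} → Decreasing ys → Decreasing (map (i +_) ys)
+-decreasing⁺ i d = Linkedₚ.map⁺ (Linked.map (+-monoʳ-< i) d)

+-decreasing⁻ : ∀ i {ys} → Decreasing (map (i +_) ys) → Decreasing ys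
+-decreasing⁻ i d = Linked.map (+-cancelˡ-< i _ _) (Linkedₚ.map⁻ d)

+-contiguous⁺ : ∀ i {ys} → Contiguous ys → Contiguous (map (i +_) ys)
+-contiguous⁺ i c = Linkedₚ.map⁺ (Linked.map shift c)
  where
  shift : ∀ {a b} → a ≡ b ⊎ a ≡ suc b → i + a ≡ i + b ⊎ i + a ≡ suc (i + b)
  shift (inj₁ refl) = inj₁ refl
  shift {b = b} (inj₂ refl) = inj₂ (+-suc i b)

+-contiguous⁻ : ∀ i {ys} → Contiguous (map (i +_) ys) → Contiguous ys
+-contiguous⁻ i c = Linked.map unshift (Linkedₚ.map⁻ c)
  where
  unshift : ∀ {a b} → i + a ≡ i + b ⊎ i + a ≡ suc (i + b) → a ≡ b ⊎ a ≡ suc b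
  unshift {a} {b} (inj₁ eq) = inj₁ (+-cancelˡ-≡ i a b eq)
  unshift {a} {b} (inj₂ eq) = inj₂ (+-cancelˡ-≡ i a (suc b) (trans eq (sym (+-suc i b))))

+-above⁺ : ∀ i {ys} → Positive ys → All (i <_) (map (i +_) ys)
+-above⁺ i p = map⁺ (All.map (m<m+n i) p)

+-positive⁻ : ∀ i {ys} → All (i <_) (map (i +_) ys) → Positive ys
+-positive⁻ i a = All.map (λ {y} i<i+y → +-cancelˡ-< i 0 y (subst (_< i + y) (sym (+-identityʳ i)) i<i+y))
                          (map⁻ a)

-- Conjugation

-- Adding a largest part x to a partition lengthens each of its columns by one
-- and adds x − (number of columns) new columns of height one.
conj : List ℕ → List ℕ
conj []       = []
conj (x ∷ xs) = map suc (conj xs) ++ replicate (x ∸ length (conj xs)) 1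

length-conj : ∀ {xs} → Nonincreasing xs → length (conj xs) ≡ firstPart xs
columns-∷ : ∀ {x xs} → Nonincreasing (x ∷ xs) → length (conj xs) + (x ∸ length (conj xs)) ≡ x

length-conj {[]}     _ = refl
length-conj {x ∷ xs} d = begin
  length (map suc c ++ replicate (x ∸ length c) 1)    ≡⟨ length-++ (map suc c) ⟩
  length (map suc c) + length (replicate (x ∸ length c) 1)
    ≡⟨ cong₂ _+_ (length-map suc c) (length-replicate (x ∸ length c)) ⟩
  length c + (x ∸ length c)                            ≡⟨ columns-∷ d ⟩
  x                                                    ∎
  where open ≡-Reasoning
        c = conj xs

columns-∷ {x} d =
  trans (cong (λ h → h + (x ∸ h)) (length-conj (Linked.tail d))) (m+[n∸m]≡n (firstPart-≤ d))

sum-replicate-1 : ∀ k → sum (replicate k 1) ≡ k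
sum-replicate-1 zero    = refl
sum-replicate-1 (suc k) = cong suc (sum-replicate-1 k)

sum-conj : ∀ {xs} → Nonincreasing xs → sum (conj xs) ≡ sum xs
sum-conj {[]}     _ = refl
sum-conj {x ∷ xs} d = begin
  sum (map suc c ++ replicate (x ∸ length c) 1)       ≡⟨ sum-++ (map suc c) _ ⟩
  sum (map suc c) + sum (replicate (x ∸ length c) 1)  ≡⟨ cong₂ _+_ (sum-map-suc c) (sum-replicate-1 _) ⟩
  sum c + length c + (x ∸ length c)                   ≡⟨ +-assoc (sum c) _ _ ⟩
  sum c + (length c + (x ∸ length c))                 ≡⟨ cong₂ _+_ (sum-conj (Linked.tail d)) (columns-∷ d) ⟩
  sum xs + x                                          ≡⟨ +-comm (sum xs) x ⟩
  x + sum xs                                          ∎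
  where open ≡-Reasoning
        c = conj xs

conj-positive : ∀ xs → Positive (conj xs)
conj-positive []       = []
conj-positive (x ∷ xs) = ++⁺ (map⁺ (All.universal (λ _ → z<s) (conj xs))) (replicate⁺ _ z<s)

conj-replicate-1 : ∀ k → conj (replicate (suc k) 1) ≡ suc k ∷ []
conj-replicate-1 zero    = refl
conj-replicate-1 (suc k) rewrite conj-replicate-1 k = refl

conj-map-suc-++ : ∀ ys k → 1 ≤ length ys + k →
  conj (map suc ys ++ replicate k 1) ≡ (length ys + k) ∷ conj ys
conj-map-suc-++ []           (suc k) _ = conj-replicate-1 k
conj-map-suc-++ (y ∷ [])     zero    _ = refl
conj-map-suc-++ (y ∷ [])     (suc k) _ rewrite conj-replicate-1 k = refl
conj-map-suc-++ (y ∷ y′ ∷ ys) k      _ rewrite conj-map-suc-++ (y′ ∷ ys) k (s≤s z≤n) = refl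

conj-involutive : ∀ {xs} → Nonincreasing xs → Positive xs → conj (conj xs) ≡ xs
conj-involutive {[]}     _ _          = refl
conj-involutive {x ∷ xs} d (0<x ∷ ps) =
  trans (conj-map-suc-++ (conj xs) _ (subst (1 ≤_) (sym (columns-∷ d)) 0<x))
        (cong₂ _∷_ (columns-∷ d) (conj-involutive (Linked.tail d) ps))

conj-∷ʳ-0 : ∀ xs → conj (xs ∷ʳ 0) ≡ conj xs
conj-∷ʳ-0 []       = refl
conj-∷ʳ-0 (x ∷ xs) = cong (λ c → map suc c ++ replicate (x ∸ length c) 1) (conj-∷ʳ-0 xs)

contiguous-replicate : ∀ k v → Contiguous (replicate k v)
contiguous-replicate zero          v = []
contiguous-replicate (suc zero)    v = [-]
contiguous-replicate (suc (suc k)) v = inj₁ refl ∷ contiguous-replicate (suc k) v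

conj-contiguous : ∀ {x xs} → Decreasing (x ∷ xs) → Positive (x ∷ xs) →
  Contiguous (conj (x ∷ xs)) × EndsIn 1 (conj (x ∷ xs))
conj-contiguous {zero}  {[]} _ (() ∷ _)
conj-contiguous {suc x} {[]} _ _        = contiguous-replicate (suc x) 1 , EndsIn-replicate x 1
conj-contiguous {suc x} {y ∷ ys} (s≤s y≤x ∷ d) (_ ∷ ps) with conj-contiguous d ps
... | c , e rewrite length-conj (decreasing⇒nonincreasing d) | +-∸-assoc 1 y≤x =
  Linked-++ (+-contiguous⁺ 1 c) (EndsIn-map⁺ suc e) (inj₂ refl) (contiguous-replicate (suc (x ∸ y)) 1) ,
  EndsIn-++⁺ʳ (map suc (conj (y ∷ ys))) (EndsIn-replicate (x ∸ y) 1)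

conj-decreasing : ∀ {xs} → Contiguous xs → EndsIn 1 xs → Decreasing (conj xs)
conj-decreasing [-] last = [-]
conj-decreasing {x ∷ y ∷ ys} (x≈y ∷ c) (_ ∷ e)
  rewrite length-conj (contiguous⇒nonincreasing c) with x≈y
... | inj₁ refl rewrite n∸n≡0 y | ++-identityʳ (map suc (conj (y ∷ ys))) =
  +-decreasing⁺ 1 (conj-decreasing c e)
... | inj₂ refl rewrite m+n∸n≡m 1 y =
  Linked-∷ʳ (+-decreasing⁺ 1 (conj-decreasing c e)) (+-above⁺ 1 (conj-positive (y ∷ ys)))

contiguous-interval : ∀ {a z xs} → Contiguous xs → a ∈ xs → a ≤ z → z ≤ firstPart xs → z ∈ xs
contiguous-interval {a} {z} {y ∷ ys} c a∈ a≤z z≤y with z ≟ y | a∈ | c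
... | yes refl | _          | _          = here refl
... | no z≢y   | here refl  | _          = ⊥-elim (z≢y (≤-antisym z≤y a≤z))
... | no z≢y   | there a∈ys | y≈u ∷ c′   = there (contiguous-interval c′ a∈ys a≤z (below y≈u))
  where
  below : ∀ {u} → y ≡ u ⊎ y ≡ suc u → z ≤ u
  below (inj₁ refl) = <⇒≤ (≤∧≢⇒< z≤y z≢y)
  below (inj₂ refl) = ≤-pred (≤∧≢⇒< z≤y z≢y)

contiguous⇒gapFree : ∀ {xs} → Contiguous xs → GapFree xs
contiguous⇒gapFree c a b z a∈ b∈ a≤z z≤b =
  contiguous-interval c a∈ a≤z (≤-trans z≤b (∈⇒≤-firstPart (contiguous⇒nonincreasing c) b∈))

gapFree-tail : ∀ {x u rest} → Nonincreasing (x ∷ u ∷ rest) → GapFree (x ∷ u ∷ rest) → GapFree (u ∷ rest)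
gapFree-tail d g a b z a∈ b∈ a≤z z≤b with g a b z (there a∈) (there b∈) a≤z z≤b
... | there z∈ = z∈
... | here refl = here (≤-antisym (≤-trans z≤b (∈⇒≤-firstPart (Linked.tail d) b∈)) (Linked.head d))

gapFree⇒contiguous : ∀ {xs} → Nonincreasing xs → GapFree xs → Contiguous xs
gapFree⇒contiguous {[]}             _ _ = []
gapFree⇒contiguous {x ∷ []}         _ _ = [-]
gapFree⇒contiguous {x ∷ u ∷ rest} d g = adjacent ∷ gapFree⇒contiguous (Linked.tail d) (gapFree-tail d g)
  where
  adjacent : x ≡ u ⊎ x ≡ suc u
  adjacent with m≤n⇒m<n∨m≡n (Linked.head d)
  ... | inj₂ u≡x = inj₁ (sym u≡x)
  ... | inj₁ u<x with m≤n⇒m<n∨m≡n u<x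
  ...   | inj₂ 1+u≡x = inj₂ (sym 1+u≡x)
  ...   | inj₁ 1+u<x = ⊥-elim (1+u∉ (g u x (suc u) (there (here refl)) (here refl) (n≤1+n u) (<⇒≤ 1+u<x)))
    where
    1+u∉ : suc u ∉ x ∷ u ∷ rest
    1+u∉ (here 1+u≡x)          = <⇒≢ 1+u<x 1+u≡x
    1+u∉ (there (here 1+u≡u))  = 1+n≢n 1+u≡u
    1+u∉ (there (there 1+u∈))  = 1+n≰n (∈⇒≤-firstPart (Linked.tail d) (there 1+u∈))

smallest<firstPart : ∀ {xs} → Nonincreasing xs → TwoDistinctValues xs → smallest xs < firstPart xs
smallest<firstPart d (a , b , a∈ , b∈ , a≢b) with m≤n⇒m<n∨m≡n (smallest-≤ a∈)
... | inj₁ s<a = <-≤-trans s<a (∈⇒≤-firstPart d a∈)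
... | inj₂ s≡a = <-≤-trans (≤∧≢⇒< (smallest-≤ b∈) (λ s≡b → a≢b (trans (sym s≡a) s≡b))) (∈⇒≤-firstPart d b∈)

EndsIn⇒firstPart-∈ : ∀ {v xs} → EndsIn v xs → firstPart xs ∈ xs
EndsIn⇒firstPart-∈ last    = here refl
EndsIn⇒firstPart-∈ (_ ∷ _) = here refl

firstPart-conj : ∀ {σ} → Nonincreasing (conj σ) → Nonincreasing σ → Positive σ → firstPart (conj σ) ≡ length σ
firstPart-conj dc d p = trans (sym (length-conj dc)) (cong length (conj-involutive d p))

fromStrict : List ℕ × ℕ → List ℕ
fromStrict (σ , e) = map (e +_) (conj σ)

weight : List ℕ × ℕ → ℕ
weight (σ , e) = sum σ + e * firstPart σ

sum-fromStrict : ∀ {σ} e → Nonincreasing σ → sum (fromStrict (σ , e)) ≡ weight (σ , e)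
sum-fromStrict {σ} e d =
  trans (sum-map-+ e (conj σ)) (cong₂ (λ s k → s + e * k) (sum-conj d) (length-conj d))

smallest-fromStrict : ∀ {σ} e → Decreasing σ → Positive σ → 0 < length σ →
  smallest (fromStrict (σ , e)) ≡ e + 1
smallest-fromStrict {_ ∷ _} e d p _ with conj-contiguous d p
... | c , end = smallest-EndsIn (contiguous⇒nonincreasing (+-contiguous⁺ e c)) (EndsIn-map⁺ (e +_) end)

fromStrict-gapFree : ∀ {σ} e → Decreasing σ → Positive σ → 2 ≤ length σ →
  InGminusG0 (weight (σ , e)) (fromStrict (σ , e))
fromStrict-gapFree {σ@(_ ∷ _)} e d p 2≤len with conj-contiguous d p
... | c , end =
  (positive , contiguous⇒nonincreasing cπ , sum-fromStrict e (decreasing⇒nonincreasing d)) ,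
  contiguous⇒gapFree cπ ,
  e + firstPart (conj σ) , e + 1 ,
  ∈-map⁺ (e +_) (EndsIn⇒firstPart-∈ end) , ∈-map⁺ (e +_) (EndsIn-∈ end) , distinct
  where
  cπ = +-contiguous⁺ e c
  positive : Positive (fromStrict (σ , e))
  positive = All.map (≤-trans (s≤s z≤n)) (+-above⁺ e (conj-positive σ))
  distinct : e + firstPart (conj σ) ≢ e + 1
  distinct eq = <⇒≢ 2≤len (sym (trans
    (sym (firstPart-conj (contiguous⇒nonincreasing c) (decreasing⇒nonincreasing d) p))
    (+-cancelˡ-≡ e _ 1 eq)))

fromStrict-injective : ∀ {σ σ′ e e′} →
  Decreasing σ → Positive σ → 0 < length σ → Decreasing σ′ → Positive σ′ → 0 < length σ′ →
  fromStrict (σ , e) ≡ fromStrict (σ′ , e′) → σ ≡ σ′ × e ≡ e′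
fromStrict-injective {σ} {σ′} {e} {e′} d p 0<len d′ p′ 0<len′ eq
  with +-cancelʳ-≡ 1 e e′ (begin
    e + 1                            ≡⟨ smallest-fromStrict e d p 0<len ⟨
    smallest (fromStrict (σ , e))    ≡⟨ cong smallest eq ⟩
    smallest (fromStrict (σ′ , e′))  ≡⟨ smallest-fromStrict e′ d′ p′ 0<len′ ⟩
    e′ + 1                           ∎)
  where open ≡-Reasoning
... | refl = trans (sym (conj-involutive (decreasing⇒nonincreasing d) p))
               (trans (cong conj (map-injective (+-cancelˡ-≡ e _ _) eq))
                      (conj-involutive (decreasing⇒nonincreasing d′) p′)) ,
             refl

shifted-surjective : ∀ {π e ρ} → π ≡ map (e +_) ρ → Nonincreasing π → GapFree π → TwoDistinctValues π →
  smallest π ≡ e + 1 → ∃[ σ ] (Decreasing σ × Positive σ × 2 ≤ length σ × fromStrict (σ , e) ≡ π)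
shifted-surjective {ρ = []}              refl _ _ (_ , _ , () , _) _
shifted-surjective {e = e} {ρ@(r ∷ rs)} refl d gf two sm =
  conj ρ , conj-decreasing cρ endρ , conj-positive ρ , 2≤length , cong (map (e +_)) (conj-involutive dρ posρ)
  where
  cρ = +-contiguous⁻ e (gapFree⇒contiguous d gf)
  dρ = contiguous⇒nonincreasing cρ
  smρ : smallest ρ ≡ 1
  smρ = +-cancelˡ-≡ e _ 1 (trans (sym (smallest-map-+ e r rs)) sm)
  endρ : EndsIn 1 ρ
  endρ = subst (λ v → EndsIn v ρ) smρ (EndsIn-smallest dρ)
  posρ : Positive ρ
  posρ = All.tabulate (λ x∈ → subst (_≤ _) smρ (smallest-≤ x∈))
  2≤length : 2 ≤ length (conj ρ)
  2≤length = subst (2 ≤_) (sym (length-conj dρ))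
    (+-cancelˡ-< e 1 r (subst (_< e + r) sm (smallest<firstPart d two)))

fromStrict-surjective : ∀ {n π} → InGminusG0 n π →
  ∃[ e ] ∃[ σ ] (Decreasing σ × Positive σ × 2 ≤ length σ × fromStrict (σ , e) ≡ π)
fromStrict-surjective {π = π} ((pos , d , _) , gf , two@(_ , _ , a∈ , _)) =
  e , shifted-surjective (proj₂ (shift-view above)) d gf two (sym (m∸n+n≡m 1≤m))
  where
  1≤m : 1 ≤ smallest π
  1≤m = All.lookup pos (smallest-∈ a∈)
  e = smallest π ∸ 1
  above : All (e ≤_) π
  above = All.tabulate (λ x∈ → ≤-trans (m∸n≤m (smallest π) 1) (smallest-≤ x∈))

-- The step map

-- (τ , e) stands for (σ , e), where σ is a strict partition into L or L + 1 parts: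
-- τ is σ, followed by a zero part when σ has only L parts.
State : ℕ → List ℕ × ℕ → Set
State L (τ , e) = Decreasing τ × length τ ≡ suc L

ZeroPadded : List ℕ → Set
ZeroPadded τ = ∃[ σ ] (Positive σ × τ ≡ σ ∷ʳ 0)

Base : List ℕ × ℕ → Set
Base (τ , e) = ZeroPadded τ × e ≡ 0

zeroPadded⊎positive : ∀ {τ} → Decreasing τ → ZeroPadded τ ⊎ Positive τ
zeroPadded⊎positive {[]}         _ = inj₂ []
zeroPadded⊎positive {zero ∷ []}  _ = inj₁ ([] , [] , refl)
zeroPadded⊎positive {suc x ∷ []} _ = inj₂ (z<s ∷ [])
zeroPadded⊎positive {x ∷ y ∷ ys} (y<x ∷ d) with zeroPadded⊎positive d
... | inj₁ (σ , p , eq) = inj₁ (x ∷ σ , ≤-trans (s≤s z≤n) y<x ∷ p , cong (x ∷_) eq)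
... | inj₂ p            = inj₂ (≤-trans (s≤s z≤n) y<x ∷ p)

positive⇒¬zeroPadded : ∀ {τ} → Positive τ → ¬ ZeroPadded τ
positive⇒¬zeroPadded p (σ , _ , refl) = <-irrefl refl (All.lookup p (∈-++⁺ʳ σ (here refl)))

-- All parts but the first are raised by one. If the second part thereby reaches the first
-- part M, then M is absorbed into the offset e; as M is also the new first part, this
-- leaves sum τ + e * firstPart τ unchanged.
settle : ℕ → List ℕ → ℕ → List ℕ × ℕ
settle M B e with firstPart B ≟ M
... | yes _ = B ∷ʳ 0 , suc e
... | no  _ = M ∷ B , e

step : List ℕ × ℕ → List ℕ × ℕ
step ([] , e)    = [] , e
step (M ∷ S , e) = settle M (map suc S) e

settle-absorb : ∀ {M B e} → firstPart B ≡ M → settle M B e ≡ (B ∷ʳ 0 , suc e)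
settle-absorb {M} {B} eq with firstPart B ≟ M
... | yes _  = refl
... | no neq = ⊥-elim (neq eq)

settle-keep : ∀ {M B e} → firstPart B ≢ M → settle M B e ≡ (M ∷ B , e)
settle-keep {M} {B} neq with firstPart B ≟ M
... | yes eq = ⊥-elim (neq eq)
... | no _   = refl

decreasing-∷ : ∀ {M B} → firstPart B < M → Decreasing B → Decreasing (M ∷ B)
decreasing-∷ {B = []}    _    _ = [-]
decreasing-∷ {B = _ ∷ _} B<M d = B<M ∷ d

firstPart<head : ∀ {M B} → Decreasing (M ∷ B) → 0 < M → firstPart B < M
firstPart<head [-]       0<M = 0<M
firstPart<head (b<M ∷ _) _   = b<M

raise-≤ : ∀ {M S} → Decreasing (M ∷ S) → firstPart (map suc S) ≤ M
raise-≤ [-]       = z≤n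
raise-≤ (s<M ∷ _) = s<M

lower-tail : ∀ {M S} → Decreasing (M ∷ map suc S) → Decreasing (M ∷ S)
lower-tail {S = []}    _            = [-]
lower-tail {S = s ∷ _} (1+s<M ∷ d) = <-trans (n<1+n s) 1+s<M ∷ +-decreasing⁻ 1 d

raise-positive : ∀ S → Positive (map suc S)
raise-positive S = map⁺ (All.universal (λ _ → z<s) S)

sum-raise : ∀ {L} S → length S ≡ L → sum (map suc S) ≡ sum S + L
sum-raise S len = trans (sum-map-suc S) (cong (sum S +_) len)

step-state : ∀ {L x} → State L x → State L (step x)
step-state {x = [] , _} (_ , ())
step-state {L} {M ∷ S , e} (d , len) with firstPart (map suc S) ≟ M
... | yes _   = Linked-∷ʳ dB (raise-positive S) ,
                trans (length-∷ʳ (map suc S) 0) (cong suc (trans (length-map suc S) (suc-injective len)))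
  where dB = +-decreasing⁺ 1 (Linked.tail d)
... | no neq  = decreasing-∷ (≤∧≢⇒< (raise-≤ d) neq) (+-decreasing⁺ 1 (Linked.tail d)) ,
                cong suc (trans (length-map suc S) (suc-injective len))

step-weight : ∀ {L x} → State L x → weight (step x) ≡ weight x + L
step-weight {x = [] , _} (_ , ())
step-weight {L} {M ∷ S , e} (d , len) with firstPart (map suc S) ≟ M
... | yes B≡M = begin
  sum (B ∷ʳ 0) + suc e * firstPart (B ∷ʳ 0)
    ≡⟨ cong₂ (λ s f → s + suc e * f) (sum-∷ʳ-0 B) (trans (firstPart-∷ʳ-0 B) B≡M) ⟩
  sum B + suc e * M           ≡⟨ cong (_+ suc e * M) (sum-raise S (suc-injective len)) ⟩
  sum S + L + suc e * M       ≡⟨ rearrange (sum S) L M e ⟩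
  M + sum S + e * M + L       ∎
  where
  open ≡-Reasoning
  B = map suc S
  rearrange : ∀ s L M e → s + L + suc e * M ≡ M + s + e * M + L
  rearrange = solve-∀
... | no _ = begin
  M + sum (map suc S) + e * M ≡⟨ cong (λ s → M + s + e * M) (sum-raise S (suc-injective len)) ⟩
  M + (sum S + L) + e * M     ≡⟨ rearrange (sum S) L M e ⟩
  M + sum S + e * M + L       ∎
  where
  open ≡-Reasoning
  rearrange : ∀ s L M e → M + (s + L) + e * M ≡ M + s + e * M + L
  rearrange = solve-∀

kept-positive : ∀ {M S} → Decreasing (M ∷ S) → firstPart (map suc S) ≢ M → Positive (M ∷ map suc S)
kept-positive {S = S} d neq = ≤-trans (s≤s z≤n) (≤∧≢⇒< (raise-≤ d) neq) ∷ raise-positive S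

step-nonBase : ∀ {L x} → State L x → ¬ Base (step x)
step-nonBase {x = [] , _} (_ , ())
step-nonBase {x = M ∷ S , e} (d , _) with firstPart (map suc S) ≟ M
... | yes _  = λ ()
... | no neq = λ (zp , _) → positive⇒¬zeroPadded (kept-positive d neq) zp

step-injective : ∀ {L x x′} → State L x → State L x′ → step x ≡ step x′ → x ≡ x′
step-injective {x = [] , _} (_ , ()) _
step-injective {x′ = [] , _} _ (_ , ())
step-injective {x = M ∷ S , e} {M′ ∷ S′ , e′} (d , _) (d′ , _) eq
  with firstPart (map suc S) ≟ M | firstPart (map suc S′) ≟ M′
... | yes B≡M | yes B′≡M′ = cong₂ _,_ (cong₂ _∷_ M≡M′ S≡S′) (suc-injective (cong proj₂ eq))
  where
  B≡B′ = ∷ʳ-injectiveˡ (map suc S) (map suc S′) (cong proj₁ eq)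
  S≡S′ = map-injective suc-injective B≡B′
  M≡M′ = trans (sym B≡M) (trans (cong firstPart B≡B′) B′≡M′)
... | yes _   | no neq′   =
  ⊥-elim (positive⇒¬zeroPadded (kept-positive d′ neq′) (map suc S , raise-positive S , sym (cong proj₁ eq)))
... | no neq  | yes _     =
  ⊥-elim (positive⇒¬zeroPadded (kept-positive d neq) (map suc S′ , raise-positive S′ , cong proj₁ eq))
... | no _    | no _      with ∷-injective (cong proj₁ eq)
...   | M≡M′ , B≡B′ = cong₂ _,_ (cong₂ _∷_ M≡M′ (map-injective suc-injective B≡B′)) (cong proj₂ eq)

absorbed-predecessor : ∀ {L σ e} → Positive σ → Decreasing (σ ∷ʳ 0) → length σ ≡ suc L →
  ∃[ x ] (State (suc L) x × step x ≡ (σ ∷ʳ 0 , suc e))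
absorbed-predecessor {e = e} p d len with shift-view p
... | s ∷ S , refl =
  (suc s ∷ s ∷ S , e) ,
  (n<1+n s ∷ +-decreasing⁻ 1 (Linked-++⁻ˡ (map suc (s ∷ S)) d) ,
   cong suc (trans (sym (length-map suc (s ∷ S))) len)) ,
  settle-absorb refl

kept-predecessor : ∀ {L M B e} → Positive (M ∷ B) → Decreasing (M ∷ B) → length B ≡ L →
  ∃[ x ] (State L x × step x ≡ (M ∷ B , e))
kept-predecessor {M = M} {e = e} (0<M ∷ p) d len with shift-view p
... | S , refl =
  (M ∷ S , e) ,
  (lower-tail d , cong suc (trans (sym (length-map suc S)) len)) ,
  settle-keep (<⇒≢ (firstPart<head d 0<M))

base⊎step : ∀ {L y} → State (suc L) y → Base y ⊎ ∃[ x ] (State (suc L) x × step x ≡ y)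
base⊎step {y = τ , e} (d , len) with zeroPadded⊎positive d
base⊎step {y = τ , zero}  (d , len) | inj₁ zp = inj₁ (zp , refl)
base⊎step {y = τ , suc e} (d , len) | inj₁ (σ , p , refl) =
  inj₂ (absorbed-predecessor p d (suc-injective (trans (sym (length-∷ʳ σ 0)) len)))
base⊎step {y = [] , e}     (d , ()) | inj₂ p
base⊎step {y = M ∷ B , e} (d , len) | inj₂ p = inj₂ (kept-predecessor p d (suc-injective len))

¬even-suc : ∀ {n} → 2 ∣ n → ¬ 2 ∣ suc n
¬even-suc {n} 2∣n 2∣1+n with ∣1⇒≡1 (∣m+n∣m⇒∣n (subst (2 ∣_) (+-comm 1 n) 2∣1+n) 2∣n)
... | ()

evenBelow : ∀ m → ∃[ L ] (2 ∣ L × (m ≡ L ⊎ m ≡ suc L))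
evenBelow zero          = 0 , divides 0 refl , inj₁ refl
evenBelow (suc zero)    = 0 , divides 0 refl , inj₂ refl
evenBelow (suc (suc m)) with evenBelow m
... | L , 2∣L , inj₁ refl = suc (suc L) , ∣m∣n⇒∣m+n ∣-refl 2∣L , inj₁ refl
... | L , 2∣L , inj₂ refl = suc (suc L) , ∣m∣n⇒∣m+n ∣-refl 2∣L , inj₂ refl

evenBelow-unique : ∀ {m L L′} → 2 ∣ L → 2 ∣ L′ → m ≡ L ⊎ m ≡ suc L → m ≡ L′ ⊎ m ≡ suc L′ → L ≡ L′
evenBelow-unique _   _    (inj₁ refl) (inj₁ refl) = refl
evenBelow-unique _   _    (inj₂ refl) (inj₂ refl) = refl
evenBelow-unique 2∣L 2∣L′ (inj₁ refl) (inj₂ refl) = ⊥-elim (¬even-suc 2∣L′ 2∣L)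
evenBelow-unique 2∣L 2∣L′ (inj₂ refl) (inj₁ refl) = ⊥-elim (¬even-suc 2∣L 2∣L′)

data Unpadded (L : ℕ) : List ℕ → List ℕ → Set where
  padded   : ∀ {σ} → length σ ≡ L → Unpadded L (σ ∷ʳ 0) σ
  unpadded : ∀ {σ} → length σ ≡ suc L → Unpadded L σ σ

Unpadded-length : ∀ {L τ σ} → Unpadded L τ σ → length σ ≡ L ⊎ length σ ≡ suc L
Unpadded-length (padded len)   = inj₁ len
Unpadded-length (unpadded len) = inj₂ len

state-view : ∀ {L τ e} → State L (τ , e) → ∃[ σ ] (Decreasing σ × Positive σ × Unpadded L τ σ)
state-view (d , len) with zeroPadded⊎positive d
... | inj₁ (σ , p , refl) = σ , Linked-++⁻ˡ σ d , p , padded (suc-injective (trans (sym (length-∷ʳ σ 0)) len))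
... | inj₂ p              = _ , d , p , unpadded len

Unpadded-state : ∀ {L τ σ e} → Decreasing σ → Positive σ → Unpadded L τ σ → State L (τ , e)
Unpadded-state {σ = σ} d p (padded len) = Linked-∷ʳ d p , trans (length-∷ʳ σ 0) (cong suc len)
Unpadded-state d p (unpadded len)       = d , len

Unpadded-fromStrict : ∀ {L τ σ} e → Unpadded L τ σ → fromStrict (τ , e) ≡ fromStrict (σ , e)
Unpadded-fromStrict {σ = σ} e (padded _) = cong (map (e +_)) (conj-∷ʳ-0 σ)
Unpadded-fromStrict e (unpadded _)       = refl

Unpadded-weight : ∀ {L τ σ} e → Unpadded L τ σ → weight (τ , e) ≡ weight (σ , e)
Unpadded-weight {σ = σ} e (padded _) = cong₂ (λ s f → s + e * f) (sum-∷ʳ-0 σ) (firstPart-∷ʳ-0 σ)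
Unpadded-weight e (unpadded _)       = refl

Unpadded-unique : ∀ {L L′ τ τ′ σ} → 2 ∣ L → 2 ∣ L′ → Unpadded L τ σ → Unpadded L′ τ′ σ → L ≡ L′ × τ ≡ τ′
Unpadded-unique 2∣L 2∣L′ u u′ with evenBelow-unique 2∣L 2∣L′ (Unpadded-length u) (Unpadded-length u′)
Unpadded-unique _ _ (padded _)     (padded _)      | refl = refl , refl
Unpadded-unique _ _ (unpadded _)   (unpadded _)    | refl = refl , refl
Unpadded-unique _ _ (padded len)   (unpadded len′) | refl = ⊥-elim (1+n≢n (trans (sym len′) len))
Unpadded-unique _ _ (unpadded len) (padded len′)   | refl = ⊥-elim (1+n≢n (trans (sym len) len′))

Unpadded-2≤length : ∀ {k τ σ} → 2 ∣ suc k → Unpadded (suc k) τ σ → 2 ≤ length σ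
Unpadded-2≤length 2∣L (padded len)   = subst (2 ≤_) (sym len) (∣⇒≤ 2∣L)
Unpadded-2≤length _   (unpadded len) = subst (2 ≤_) (sym len) (s≤s (s≤s z≤n))

unpadded-choice : ∀ {σ} → 2 ≤ length σ → ∃[ k ] ∃[ τ ] (2 ∣ suc k × Unpadded (suc k) τ σ)
unpadded-choice {σ} 2≤len with evenBelow (length σ)
... | zero  , _   , inj₁ len = ⊥-elim (<⇒≱ 2≤len (≤-trans (≤-reflexive len) z≤n))
... | zero  , _   , inj₂ len = ⊥-elim (<⇒≱ 2≤len (≤-reflexive len))
... | suc k , 2∣L , inj₁ len = k , σ ∷ʳ 0 , 2∣L , padded len
... | suc k , 2∣L , inj₂ len = k , σ , 2∣L , unpadded len

module Steps (k : ℕ) =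
  Orbits (State (suc k)) Base step weight z<s
         (step-state {suc k}) (step-weight {suc k}) (step-injective {suc k})
         (step-nonBase {suc k}) (base⊎step {k})

state-gapFree : ∀ {k y} → 2 ∣ suc k → State (suc k) y → InGminusG0 (weight y) (fromStrict y)
state-gapFree {k} {τ , e} 2∣L s with state-view {suc k} {τ} {e} s
... | σ , d , p , u =
  subst₂ InGminusG0 (sym (Unpadded-weight e u)) (sym (Unpadded-fromStrict e u))
         (fromStrict-gapFree e d p (Unpadded-2≤length 2∣L u))

state-injective : ∀ {k k′ y y′} → 2 ∣ suc k → 2 ∣ suc k′ → State (suc k) y → State (suc k′) y′ →
  fromStrict y ≡ fromStrict y′ → k ≡ k′ × y ≡ y′
state-injective {k} {k′} {τ , e} {τ′ , e′} 2∣L 2∣L′ s s′ eq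
  with state-view {suc k} {τ} {e} s | state-view {suc k′} {τ′} {e′} s′
... | σ , d , p , u | σ′ , d′ , p′ , u′
  with fromStrict-injective d p (nonempty 2∣L u) d′ p′ (nonempty 2∣L′ u′)
         (trans (sym (Unpadded-fromStrict e u)) (trans eq (Unpadded-fromStrict e′ u′)))
  where
  nonempty : ∀ {k τ σ} → 2 ∣ suc k → Unpadded (suc k) τ σ → 0 < length σ
  nonempty 2∣L u = ≤-trans (s≤s z≤n) (Unpadded-2≤length 2∣L u)
... | refl , refl with Unpadded-unique 2∣L 2∣L′ u u′
... | refl , refl = refl , refl

state-surjective : ∀ {n π} → InGminusG0 n π →
  ∃[ k ] ∃[ y ] (2 ∣ suc k × State (suc k) y × weight y ≡ n × fromStrict y ≡ π)
state-surjective g@((_ , _ , sum≡n) , _) with fromStrict-surjective g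
... | e , σ , d , p , 2≤len , eqπ with unpadded-choice 2≤len
... | k , τ , 2∣L , u =
  k , (τ , e) , 2∣L , s ,
  trans (sym (sum-fromStrict e (decreasing⇒nonincreasing (proj₁ s)))) (trans (cong sum eqπ′) sum≡n) ,
  eqπ′
  where
  s = Unpadded-state {e = e} d p u
  eqπ′ = trans (Unpadded-fromStrict e u) eqπ

nonincreasing∧unique⇒decreasing : ∀ {xs} → Nonincreasing xs → Unique xs → Decreasing xs
nonincreasing∧unique⇒decreasing []      _                  = []
nonincreasing∧unique⇒decreasing [-]     _                  = [-]
nonincreasing∧unique⇒decreasing (y≤x ∷ d) ((x≢y ∷ _) ∷ u) =
  ≤∧≢⇒< y≤x (λ y≡x → x≢y (sym y≡x)) ∷ nonincreasing∧unique⇒decreasing d u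

decreasing⇒unique : ∀ {xs} → Decreasing xs → Unique xs
decreasing⇒unique d =
  AllPairs.map (λ y<x x≡y → <-irrefl (sym x≡y) y<x) (Linkedₚ.Linked⇒AllPairs (λ z<y y<x → <-trans y<x z<y) d)

marked-analysis : ∀ {n l i} → 1 ≤ n → InDE n l → i < smallest l →
  ∃[ k ] ∃[ ν ] (l ≡ map (i +_) ν × length ν ≡ suc k × 2 ∣ suc k × Decreasing ν × Positive ν)
marked-analysis {l = l} {i} 1≤n ((_ , d , sum≡n) , u , 2∣len) i<s
  with shift-view {i} {l} (All.map <⇒≤ (<smallest⇒All i<s))
... | []    , refl = ⊥-elim (<⇒≢ 1≤n sum≡n)
... | ν@(_ ∷ vs) , refl =
  length vs , ν , refl , refl , subst (2 ∣_) (length-map (i +_) ν) 2∣len ,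
  +-decreasing⁻ i (nonincreasing∧unique⇒decreasing d u) , +-positive⁻ i (<smallest⇒All i<s)

start : List ℕ → List ℕ × ℕ
start ν = ν ∷ʳ 0 , 0

start-state : ∀ {L ν} → Decreasing ν → Positive ν → length ν ≡ L → State L (start ν)
start-state {ν = ν} d p len = Linked-∷ʳ d p , trans (length-∷ʳ ν 0) (cong suc len)

start-base : ∀ {ν} → Positive ν → Base (start ν)
start-base p = (_ , p , refl) , refl

weight-start : ∀ ν → weight (start ν) ≡ sum ν
weight-start ν = trans (+-identityʳ _) (sum-∷ʳ-0 ν)

toGapFree : List ℕ × ℕ → List ℕ
toGapFree (l , i) = fromStrict (fold (start (map (_∸ i) l)) step i)

toGapFree-shift : ∀ i ν → toGapFree (map (i +_) ν , i) ≡ fromStrict (fold (start ν) step i)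
toGapFree-shift i ν = cong (λ ν′ → fromStrict (fold (start ν′) step i)) (map-∸-+ i ν)

weight-orbit-start : ∀ k {ν} i → Decreasing ν → Positive ν → length ν ≡ suc k →
  weight (fold (start ν) step i) ≡ sum (map (i +_) ν)
weight-orbit-start k {ν} i d p len = begin
  weight (fold (start ν) step i) ≡⟨ Steps.weight-orbit k i (start-state d p len) ⟩
  weight (start ν) + i * suc k   ≡⟨ cong₂ (λ w L → w + i * L) (weight-start ν) (sym len) ⟩
  sum ν + i * length ν           ≡⟨ sum-map-+ i ν ⟨
  sum (map (i +_) ν)             ∎
  where open ≡-Reasoning

toGapFree-valid : ∀ {n l i} → 1 ≤ n → InDE n l → i < smallest l → InGminusG0 n (toGapFree (l , i))
toGapFree-valid {i = i} 1≤n de@((_ , _ , sum≡n) , _) i<s with marked-analysis 1≤n de i<s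
... | k , ν , refl , len , 2∣L , d , p =
  subst₂ InGminusG0 (trans (weight-orbit-start k i d p len) sum≡n) (sym (toGapFree-shift i ν))
         (state-gapFree 2∣L (Steps.orbit-state k i (start-state d p len)))

toGapFree-injective : ∀ {n l i l′ i′} → 1 ≤ n →
  InDE n l → i < smallest l → InDE n l′ → i′ < smallest l′ →
  toGapFree (l , i) ≡ toGapFree (l′ , i′) → (l , i) ≡ (l′ , i′)
toGapFree-injective {i = i} {i′ = i′} 1≤n de i<s de′ i′<s′ eq
  with marked-analysis 1≤n de i<s | marked-analysis 1≤n de′ i′<s′
... | k , ν , refl , len , 2∣L , d , p | k′ , ν′ , refl , len′ , 2∣L′ , d′ , p′
  with state-injective 2∣L 2∣L′ (Steps.orbit-state k i s) (Steps.orbit-state k′ i′ s′)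
         (trans (sym (toGapFree-shift i ν)) (trans eq (toGapFree-shift i′ ν′)))
  where
  s  = start-state d p len
  s′ = start-state d′ p′ len′
... | refl , orbits≡ with Steps.orbit-injective k i i′ (start-state d p len) (start-state d′ p′ len′)
                           (start-base p) (start-base p′) orbits≡
... | starts≡ , refl = cong (λ ν → map (i +_) ν , i) (∷ʳ-injectiveˡ ν ν′ (cong proj₁ starts≡))

toGapFree-surjective : ∀ {n π} → InGminusG0 n π →
  ∃[ l ] ∃[ i ] (InDE n l × i < smallest l × toGapFree (l , i) ≡ π)
toGapFree-surjective g with state-surjective g
... | k , y , 2∣L , s , weight≡n , eqπ with Steps.orbit-surjective k s
... | _ , u , (d₀ , len₀) , ((ν , p , refl) , refl) , orbit≡y =
  map (u +_) ν , u ,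
  ((All.map (≤-trans (s≤s z≤n)) above , decreasing⇒nonincreasing dl ,
    trans (sym (weight-orbit-start k u d p len)) (trans (cong weight orbit≡y) weight≡n)) ,
   decreasing⇒unique dl , subst (2 ∣_) (sym (trans (length-map (u +_) ν) len)) 2∣L) ,
  All⇒<smallest above (subst (0 <_) (sym (trans (length-map (u +_) ν) len)) z<s) ,
  trans (toGapFree-shift u ν) (trans (cong fromStrict orbit≡y) eqπ)
  where
  d = Linked-++⁻ˡ ν d₀
  len = suc-injective (trans (sym (length-∷ʳ ν 0)) len₀)
  dl = +-decreasing⁺ u d
  above = +-above⁺ u p

length-≡ : ∀ {A : Set} {xs ys : List A} → Unique xs → Unique ys → (∀ {x} → (x ∈ xs) ⇔ (x ∈ ys)) →
  length xs ≡ length ys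
length-≡ uxs uys xs⇔ys = ↭-length (∼bag⇒↭ (unique∧set⇒bag uxs uys xs⇔ys))

map-unique : ∀ {A B : Set} {f : A → B} {xs} → (∀ {x y} → x ∈ xs → y ∈ xs → f x ≡ f y → x ≡ y) →
  Unique xs → Unique (map f xs)
map-unique {xs = []}     _   []         = []
map-unique {xs = x ∷ xs} inj (x∉ ∷ u) =
  map⁺ (All.tabulate (λ y∈ fx≡fy → All.lookup x∉ y∈ (inj (here refl) (there y∈) fx≡fy))) ∷
  map-unique (λ x∈ y∈ → inj (there x∈) (there y∈)) u

module _ {A : Set} (bound : A → ℕ) where

  marked : List A → List (A × ℕ)
  marked []       = []
  marked (a ∷ as) = map (a ,_) (upTo (bound a)) ++ marked as

  length-marked : ∀ as → length (marked as) ≡ sum (map bound as)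
  length-marked []       = refl
  length-marked (a ∷ as) = begin
    length (map (a ,_) (upTo (bound a)) ++ marked as)        ≡⟨ length-++ (map (a ,_) (upTo (bound a))) ⟩
    length (map (a ,_) (upTo (bound a))) + length (marked as)
      ≡⟨ cong₂ _+_ (trans (length-map (a ,_) (upTo (bound a))) (length-upTo (bound a))) (length-marked as) ⟩
    bound a + sum (map bound as)                             ∎
    where open ≡-Reasoning

  ∈-marked⁺ : ∀ {as a i} → a ∈ as → i < bound a → (a , i) ∈ marked as
  ∈-marked⁺ {a ∷ as} (here refl) i< = ∈-++⁺ˡ (∈-map⁺ (a ,_) (∈-upTo⁺ i<))
  ∈-marked⁺ {b ∷ as} (there a∈)  i< = ∈-++⁺ʳ (map (b ,_) (upTo (bound b))) (∈-marked⁺ a∈ i<)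

  ∈-marked⁻ : ∀ {as a i} → (a , i) ∈ marked as → a ∈ as × i < bound a
  ∈-marked⁻ {b ∷ as} ai∈ with ∈-++⁻ (map (b ,_) (upTo (bound b))) ai∈
  ... | inj₁ ai∈b with ∈-map⁻ (b ,_) ai∈b
  ...   | _ , i∈ , refl = here refl , ∈-upTo⁻ i∈
  ∈-marked⁻ {b ∷ as} ai∈ | inj₂ ai∈as with ∈-marked⁻ ai∈as
  ...   | a∈ , i< = there a∈ , i<

  marked-unique : ∀ {as} → Unique as → Unique (marked as)
  marked-unique {[]}     _          = []
  marked-unique {a ∷ as} (a∉ ∷ u) =
    Uniqueₚ.++⁺ (Uniqueₚ.map⁺ (λ { refl → refl }) (Uniqueₚ.upTo⁺ (bound a))) (marked-unique u) disjoint
    where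
    disjoint : ∀ {p} → ¬ (p ∈ map (a ,_) (upTo (bound a)) × p ∈ marked as)
    disjoint (p∈a , p∈as) with ∈-map⁻ (a ,_) p∈a
    ... | _ , _ , refl = All.lookup a∉ (proj₁ (∈-marked⁻ p∈as)) refl

theorem5p5 : (n : ℕ) → 1 ≤ n → (G D : List (List ℕ)) → Enumerates (InGminusG0 n) G → Enumerates (InDE n) D → length G ≡ sum (map smallest D)
theorem5p5 n 1≤n G D (uG , G⇔) (uD , D⇔) = begin
  length G                                   ≡⟨ length-≡ uG unique same ⟩
  length (map toGapFree (marked smallest D)) ≡⟨ length-map toGapFree (marked smallest D) ⟩
  length (marked smallest D)                 ≡⟨ length-marked smallest D ⟩
  sum (map smallest D)                       ∎
  where
  open ≡-Reasoning
  open Equivalence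
  injective : ∀ {p q} → p ∈ marked smallest D → q ∈ marked smallest D → toGapFree p ≡ toGapFree q → p ≡ q
  injective {l , i} {l′ , i′} p∈ q∈ with ∈-marked⁻ smallest p∈ | ∈-marked⁻ smallest q∈
  ... | l∈ , i<s | l′∈ , i′<s′ = toGapFree-injective 1≤n (to (D⇔ l) l∈) i<s (to (D⇔ l′) l′∈) i′<s′
  unique : Unique (map toGapFree (marked smallest D))
  unique = map-unique injective (marked-unique smallest uD)
  same : ∀ {π} → (π ∈ G) ⇔ (π ∈ map toGapFree (marked smallest D))
  same {π} = mk⇔ covered valid
    where
    covered : π ∈ G → π ∈ map toGapFree (marked smallest D)
    covered π∈ with toGapFree-surjective (to (G⇔ π) π∈)
    ... | l , i , de , i<s , refl = ∈-map⁺ toGapFree (∈-marked⁺ smallest (from (D⇔ l) de) i<s)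
    valid : π ∈ map toGapFree (marked smallest D) → π ∈ G
    valid π∈ with ∈-map⁻ toGapFree π∈
    ... | (l , i) , p∈ , refl with ∈-marked⁻ smallest p∈
    ...   | l∈ , i<s = from (G⇔ _) (toGapFree-valid 1≤n (to (D⇔ l) l∈) i<s)
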